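{- Let $n\ge 1$ and let $\mathcal{P}_n(s)$, for $0\le s\le n!-1$, be the permutation of $\{1,\ldots,n\}$ produced by the algorithm described in the context. For $s,s'\in\{0,\ldots,n!-1\}$ let $d(s,s')$ be the minimum number of transpositions needed to transform $\mathcal{P}_n(s)$ into $\mathcal{P}_n(s')$. If $1\le k\le n$ and $0\le s<k!$, then $d(s,0)\le k-1$.
   Context: Algorithm: given $n\ge1$ and an integer seed $s$ with $0\le s\le n!-1$, set $d_{n+1}=0$ and for $k=n,n-1,\ldots,1$ (in this order) compute $x_k=\left\lfloor \frac{s \bmod k!}{(k-1)!}\right\rfloor$, $d_k=\left\lfloor \frac{\left\lfloor \frac{s+d_{k+1}(k+1)!}{k!}\right\rfloor \bmod (k+1)^2}{k+2}\right\rfloor$, $f_{k-1}=\left(x_k-\left\lfloor \frac{s}{k!}\right\rfloor-d_k\right)\bmod k$ (so $0\le f_{k-1}\le k-1$). The output is the factoradic sequence $f_{n-1}f_{n-2}\cdots f_0$, which is converted to a permutation of the list $(1,2,\ldots,n)$ as follows: remove the element with index $f_{n-1}$ (indices starting at $0$) from the current ordered list of remaining objects and place it first; then remove the element with index $f_{n-2}$ from the re-indexed remaining list and place it second; and so on through $f_0$ (which is always $0$). The resulting arrangement is $\mathcal{P}_n(s)$. -}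

module Defs where

open import Data.Nat using (ℕ; zero; suc; _+_; _*_; _∸_; _^_; _/_; _%_; _<_; _≤_; _!; NonZero)
open import Data.Nat.Properties using (_≟_; _!≢0)
open import Data.Integer as ℤ using (ℤ; +_)
open import Data.Integer.DivMod using (_%ℕ_)
open import Data.List using (List; []; _∷_; map; upTo; length)
open import Data.Product using (_×_; _,_; ∃)
open import Relation.Binary.PropositionalEquality using (_≡_; _≢_)
open import Relation.Nullary using (yes; no)

-- d_{n+1-m} for the algorithm with parameters n, s  (m = 0 gives d_{n+1} = 0).
-- For m ≥ 1 this is d_k with k = n ∸ (m ∸ 1).
dSeq : (n s m : ℕ) → ℕ
dSeq n s zero = 0
dSeq n s (suc m) =
  let k = n ∸ m
      instance _ = k !≢0
  in (((s + dSeq n s m * (suc k) !) / k !) % (suc k ^ 2)) / suc (suc k)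

-- x_k = ⌊ (s mod k!) / (k-1)! ⌋, for k = suc j
xVal : (s j : ℕ) → ℕ
xVal s j = let instance _ = suc j !≢0 ; _ = j !≢0 in (s % (suc j) !) / j !

-- f_{k-1} = (x_k - ⌊s/k!⌋ - d_k) mod k  (integer mod, result in 0..k-1), given k and d_k
fVal : (s k dk : ℕ) → ℕ
fVal s zero dk = 0
fVal s (suc j) dk =
  let instance _ = suc j !≢0
  in ((+ xVal s j) ℤ.- (+ (s / (suc j) !)) ℤ.- (+ dk)) %ℕ suc j

-- factoradic sequence f_{n-1} f_{n-2} ... f_0 ; entry number m (from 0) has k = n ∸ m
factoradicFrom : (n s m : ℕ) → (r : ℕ) → List ℕ
factoradicFrom n s m zero = []
factoradicFrom n s m (suc r) = fVal s (n ∸ m) (dSeq n s (suc m)) ∷ factoradicFrom n s (suc m) r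

factoradic : (n s : ℕ) → List ℕ
factoradic n s = factoradicFrom n s 0 n

-- remove the element with (0-based) index i from a list, returning it and the rest
-- (out-of-range indices never occur for the algorithm's output; they return 0)
pick : ℕ → List ℕ → ℕ × List ℕ
pick i [] = 0 , []
pick zero (x ∷ xs) = x , xs
pick (suc i) (x ∷ xs) with pick i xs
... | y , ys = y , (x ∷ ys)

decode : List ℕ → List ℕ → List ℕ
decode [] rest = []
decode (f ∷ fs) rest with pick f rest
... | y , rest' = y ∷ decode fs rest'

P : (n s : ℕ) → List ℕ
P n s = decode (factoradic n s) (map suc (upTo n))

nth : List ℕ → ℕ → ℕ
nth [] p = 0
nth (x ∷ xs) zero = x
nth (x ∷ xs) (suc p) = nth xs p

swapAt : ℕ → ℕ → List ℕ → List ℕ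
swapAt i j xs = map entry (upTo (length xs))
  where
  entry : ℕ → ℕ
  entry p with p ≟ i | p ≟ j
  ... | yes _ | _ = nth xs j
  ... | no _ | yes _ = nth xs i
  ... | no _ | no _ = nth xs p

Transposition : List ℕ → List ℕ → Set
Transposition xs ys =
  ∃ λ i → ∃ λ j → i < length xs × j < length xs × i ≢ j × ys ≡ swapAt i j xs

Steps : ℕ → List ℕ → List ℕ → Set
Steps zero xs ys = xs ≡ ys
Steps (suc m) xs ys = ∃ λ zs → Transposition xs zs × Steps m zs ys

-- d(s,s') ≤ b  :  the minimum number of transpositions transforming P_n(s) into P_n(s')
-- is at most b, i.e. some sequence of at most b transpositions does it
DistLe : (n s s' b : ℕ) → Set
DistLe n s s' b = ∃ λ m → m ≤ b × Steps m (P n s) (P n s')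

module Submission where

-- For s < k! the leading n - k factoradic digits produced by the
-- algorithm all vanish: every d_j with j > k is 0 (the floors of s / j! are 0),
-- hence so is every f_{j-1} with j > k.  Decoding a 0 digit keeps the head of
-- the list in place, so P n s = pre ++ T s, where pre lists 1 .. n-k and T s is
-- the decoding of the last k digits applied to suf = (n-k+1, ..., n).  Every
-- valid digit sequence decodes to a rearrangement of its input, so T s and T 0
-- are both permutations of suf, a list of length k.  Finally, selection sort
-- turns any rearrangement of a list of length k into it by at most k - 1
-- transpositions, and transpositions act compatibly with a fixed prefix.

open import Defs
open import Data.Nat using (ℕ; zero; suc; _+_; _*_; _∸_; _/_; _≤_; _<_; _!; z≤n; s≤s)
open import Data.Nat.Properties
open import Data.Nat.DivMod using (m<n⇒m/n≡0; m<n⇒m%n≡m)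
open import Data.Integer as ℤ using (+_)
open import Data.Integer.DivMod using (n%ℕd<d)
open import Data.List using (List; []; _∷_; _++_; map; upTo; applyUpTo; length; replicate; take; drop)
open import Data.List.Properties using (length-map; length-upTo; length-++; length-take; length-drop; take++drop≡id)
open import Data.List.Relation.Binary.Permutation.Propositional using (_↭_; ↭-refl; ↭-sym; ↭-trans; ↭-prep; ↭-swap)
open import Data.List.Relation.Binary.Permutation.Propositional.Properties using (∈-resp-↭; drop-mid; shift; ↭-length; ↭-empty-inv)
open import Data.List.Membership.Propositional.Properties using (∈-∃++)
open import Data.List.Relation.Unary.Any using (here)
open import Data.Product using (_×_; _,_; ∃; proj₁; proj₂)
open import Data.Sum using (inj₁; inj₂)
open import Function using (_∘_; id; _∋_)
open import Relation.Binary.PropositionalEquality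
open import Relation.Nullary using (yes; no)
open import Data.Empty using (⊥-elim)

nth-map-applyUpTo : ∀ (f g : ℕ → ℕ) n p → p < n → nth (map f (applyUpTo g n)) p ≡ f (g p)
nth-map-applyUpTo f g (suc n) zero    _         = refl
nth-map-applyUpTo f g (suc n) (suc p) (s≤s p<n) = nth-map-applyUpTo f (g ∘ suc) n p p<n

nth-ext : ∀ {n} (xs ys : List ℕ) → length xs ≡ n → length ys ≡ n →
          (∀ p → p < n → nth xs p ≡ nth ys p) → xs ≡ ys
nth-ext []       []       _     _     _    = refl
nth-ext []       (_ ∷ _)  refl  ()    _
nth-ext (_ ∷ _)  []       refl  ()    _
nth-ext (x ∷ xs) (y ∷ ys) refl  ys≡n  same =
  cong₂ _∷_ (same 0 (s≤s z≤n)) (nth-ext xs ys refl (suc-injective ys≡n) (λ p p< → same (suc p) (s≤s p<)))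

nth-after : ∀ (a : List ℕ) y b → nth (a ++ y ∷ b) (length a) ≡ y
nth-after []      y b = refl
nth-after (_ ∷ a) y b = nth-after a y b

nth-mid : ∀ (a : List ℕ) u v b q → q ≢ length a → nth (a ++ u ∷ b) q ≡ nth (a ++ v ∷ b) q
nth-mid []      u v b zero    q≢0 = ⊥-elim (q≢0 refl)
nth-mid []      u v b (suc q) _   = refl
nth-mid (_ ∷ a) u v b zero    _   = refl
nth-mid (_ ∷ a) u v b (suc q) q≢  = nth-mid a u v b q (q≢ ∘ cong suc)

length-swapAt : ∀ i j xs → length (swapAt i j xs) ≡ length xs
length-swapAt i j xs = trans (length-map _ (upTo (length xs))) (length-upTo (length xs))

nth-swapAt-i : ∀ i j xs → i < length xs → nth (swapAt i j xs) i ≡ nth xs j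
nth-swapAt-i i j xs i<
  rewrite (nth (swapAt i j xs) i ≡ _ ∋ nth-map-applyUpTo _ id (length xs) i i<)
  with i ≟ i
... | yes _   = refl
... | no  i≢i = ⊥-elim (i≢i refl)

nth-swapAt-j : ∀ i j xs → j < length xs → j ≢ i → nth (swapAt i j xs) j ≡ nth xs i
nth-swapAt-j i j xs j< j≢i
  rewrite (nth (swapAt i j xs) j ≡ _ ∋ nth-map-applyUpTo _ id (length xs) j j<)
  with j ≟ i | j ≟ j
... | yes j≡i | _       = ⊥-elim (j≢i j≡i)
... | no _    | yes _   = refl
... | no _    | no  j≢j = ⊥-elim (j≢j refl)

nth-swapAt-other : ∀ i j xs p → p < length xs → p ≢ i → p ≢ j → nth (swapAt i j xs) p ≡ nth xs p
nth-swapAt-other i j xs p p< p≢i p≢j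
  rewrite (nth (swapAt i j xs) p ≡ _ ∋ nth-map-applyUpTo _ id (length xs) p p<)
  with p ≟ i | p ≟ j
... | yes p≡i | _       = ⊥-elim (p≢i p≡i)
... | no _    | yes p≡j = ⊥-elim (p≢j p≡j)
... | no _    | no _    = refl

swapAt-cons : ∀ i j x xs → swapAt (suc i) (suc j) (x ∷ xs) ≡ x ∷ swapAt i j xs
swapAt-cons i j x xs =
  nth-ext _ _ (length-swapAt (suc i) (suc j) (x ∷ xs)) (cong suc (length-swapAt i j xs)) entry
  where
  entry : ∀ p → p < suc (length xs) → nth (swapAt (suc i) (suc j) (x ∷ xs)) p ≡ nth (x ∷ swapAt i j xs) p
  entry zero    p< = nth-swapAt-other (suc i) (suc j) (x ∷ xs) 0 p< (λ ()) (λ ())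
  entry (suc p) (s≤s p<) with p ≟ i | p ≟ j
  ... | yes refl | _ = trans (nth-swapAt-i (suc p) (suc j) (x ∷ xs) (s≤s p<)) (sym (nth-swapAt-i p j xs p<))
  ... | no p≢i | yes refl =
    trans (nth-swapAt-j (suc i) (suc p) (x ∷ xs) (s≤s p<) (p≢i ∘ suc-injective))
          (sym (nth-swapAt-j i p xs p< p≢i))
  ... | no p≢i | no p≢j =
    trans (nth-swapAt-other (suc i) (suc j) (x ∷ xs) (suc p) (s≤s p<) (p≢i ∘ suc-injective) (p≢j ∘ suc-injective))
          (sym (nth-swapAt-other i j xs p p< p≢i p≢j))

swapAt-front : ∀ u (a : List ℕ) v b → swapAt 0 (suc (length a)) (u ∷ a ++ v ∷ b) ≡ v ∷ a ++ u ∷ b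
swapAt-front u a v b =
  nth-ext _ _ (trans (length-swapAt 0 (suc L) xs) (cong suc (length-++ a))) (cong suc (length-++ a)) entry
  where
  L = length a
  xs = u ∷ a ++ v ∷ b
  entry : ∀ p → p < suc (L + suc (length b)) → nth (swapAt 0 (suc L) xs) p ≡ nth (v ∷ a ++ u ∷ b) p
  entry zero p< = trans (nth-swapAt-i 0 (suc L) xs (subst (0 <_) (sym (cong suc (length-++ a))) p<))
                        (nth-after a v b)
  entry (suc q) p< with q ≟ L
  ... | yes refl = trans (nth-swapAt-j 0 (suc L) xs (subst (suc L <_) (sym (cong suc (length-++ a))) p<) (λ ()))
                         (sym (nth-after a u b))
  ... | no q≢L = trans (nth-swapAt-other 0 (suc L) xs (suc q) (subst (suc q <_) (sym (cong suc (length-++ a))) p<)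
                                          (λ ()) (q≢L ∘ suc-injective))
                       (nth-mid a v u b q q≢L)

transposition-front : ∀ u (a : List ℕ) v b → Transposition (u ∷ a ++ v ∷ b) (v ∷ a ++ u ∷ b)
transposition-front u a v b =
  0 , suc (length a) , s≤s z≤n , s≤s (subst (length a <_) (sym (length-++ a)) (m<m+n (length a) (s≤s z≤n))) ,
  (λ ()) , sym (swapAt-front u a v b)

transposition-cons : ∀ x {xs ys} → Transposition xs ys → Transposition (x ∷ xs) (x ∷ ys)
transposition-cons x {xs} (i , j , i< , j< , i≢j , refl) =
  suc i , suc j , s≤s i< , s≤s j< , i≢j ∘ suc-injective , sym (swapAt-cons i j x xs)

steps-cons : ∀ x m {xs ys} → Steps m xs ys → Steps m (x ∷ xs) (x ∷ ys)
steps-cons x zero    refl              = refl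
steps-cons x (suc m) (zs , t , steps) = x ∷ zs , transposition-cons x t , steps-cons x m steps

steps-prefix : ∀ (pre : List ℕ) m {xs ys} → Steps m xs ys → Steps m (pre ++ xs) (pre ++ ys)
steps-prefix []        m steps = steps
steps-prefix (x ∷ pre) m steps = steps-cons x m (steps-prefix pre m steps)

≤∸1⇒< : ∀ {m n} → 0 < n → m ≤ n ∸ 1 → m < n
≤∸1⇒< {n = suc n} _ m≤n = s≤s m≤n

-- Bring the first entry y of ys to the front
-- (one transposition unless it is already there), then sort the rest.
sort-by-transpositions : ∀ {xs} ys → xs ↭ ys → ∃ λ m → m ≤ length ys ∸ 1 × Steps m xs ys
sort-by-transpositions [] xs↭[] rewrite ↭-empty-inv xs↭[] = 0 , z≤n , refl
sort-by-transpositions (y ∷ ys) xs↭ with ∈-∃++ (∈-resp-↭ (↭-sym xs↭) (here refl))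
... | a , b , refl with a | drop-mid a [] xs↭
...   | [] | b↭ys with sort-by-transpositions ys b↭ys
...     | m , m≤ , steps = m , ≤-trans m≤ (m∸n≤m (length ys) 1) , steps-cons y m steps
sort-by-transpositions (y ∷ ys) xs↭ | _ , b , refl | u ∷ a | a+b↭ys
  with sort-by-transpositions ys (↭-trans (shift u a b) a+b↭ys)
... | m , m≤ , steps =
  suc m , ≤∸1⇒< ys-positive m≤ , (y ∷ a ++ u ∷ b) , transposition-front u a y b , steps-cons y m steps
  where
  ys-positive : 0 < length ys
  ys-positive = subst (0 <_) (↭-length a+b↭ys) (s≤s z≤n)

data Factoradic : List ℕ → ℕ → Set where
  []  : Factoradic [] 0
  _∷_ : ∀ {f fs l} → f < suc l → Factoradic fs l → Factoradic (f ∷ fs) (suc l)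

pick-↭ : ∀ i xs → i < length xs → xs ↭ proj₁ (pick i xs) ∷ proj₂ (pick i xs)
pick-↭ zero    (x ∷ xs) _        = ↭-refl
pick-↭ (suc i) (x ∷ xs) (s≤s i<) = ↭-trans (↭-prep x (pick-↭ i xs i<)) (↭-swap x _ ↭-refl)

decode-↭ : ∀ {fs l} → Factoradic fs l → ∀ xs → length xs ≡ l → decode fs xs ↭ xs
decode-↭ []                       []       _   = ↭-refl
decode-↭ (_∷_ {f} {l = l} f< fs) xs length≡ =
  ↭-trans (↭-prep _ (decode-↭ fs _ rest-length)) (↭-sym xs↭)
  where
  xs↭ : xs ↭ proj₁ (pick f xs) ∷ proj₂ (pick f xs)
  xs↭ = pick-↭ f xs (subst (f <_) (sym length≡) f<)
  rest-length : length (proj₂ (pick f xs)) ≡ l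
  rest-length = suc-injective (trans (sym (↭-length xs↭)) length≡)

fVal< : ∀ s r d → fVal s (suc r) d < suc r
fVal< s r d = n%ℕd<d (+ xVal s r ℤ.- + (_/_ s (suc r !) {{suc r !≢0}}) ℤ.- + d) (suc r)

factoradicFrom-valid : ∀ n s m r → m + r ≡ n → Factoradic (factoradicFrom n s m r) r
factoradicFrom-valid n s m zero    _ = []
factoradicFrom-valid n s m (suc r) m+r≡n =
  digit< ∷ factoradicFrom-valid n s (suc m) r (trans (sym (+-suc m r)) m+r≡n)
  where
  n∸m≡ : n ∸ m ≡ suc r
  n∸m≡ = trans (cong (_∸ m) (sym m+r≡n)) (m+n∸m≡n m (suc r))
  digit< : fVal s (n ∸ m) (dSeq n s (suc m)) < suc r
  digit< rewrite n∸m≡ = fVal< s r _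

!-mono-≤ : ∀ {m n} → m ≤ n → m ! ≤ n !
!-mono-≤ {n = zero} z≤n = ≤-refl
!-mono-≤ {m} {suc n} m≤1+n with m≤n⇒m<n∨m≡n m≤1+n
... | inj₂ refl      = ≤-refl
... | inj₁ (s≤s m≤n) = ≤-trans (!-mono-≤ m≤n) (m≤m+n (n !) (n * n !))

-- d_j = 0 whenever s < j!: by downward induction, d_{j+1} = 0 and ⌊s / j!⌋ = 0.
dSeq-vanishes : ∀ n s m → s < (n ∸ m) ! → dSeq n s (suc m) ≡ 0
dSeq-previous : ∀ n s m → s < (n ∸ m) ! → dSeq n s m ≡ 0
dSeq-previous n s zero    _  = refl
dSeq-previous n s (suc m) s< = dSeq-vanishes n s m (<-≤-trans s< (!-mono-≤ (∸-monoʳ-≤ n (n≤1+n m))))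
dSeq-vanishes n s m s<
  rewrite dSeq-previous n s m s< | +-identityʳ s | m<n⇒m/n≡0 {{(n ∸ m) !≢0}} s< = refl

-- f_J = 0 when d_{J+1} = 0 and s < J!: then x_{J+1} = ⌊s / J!⌋ = 0 and ⌊s / (J+1)!⌋ = 0.
fVal-vanishes : ∀ s J → s < J ! → fVal s (suc J) 0 ≡ 0
fVal-vanishes s J s<J! = vanish (<-≤-trans s<J! (!-mono-≤ (n≤1+n J)))
  where
  vanish : s < suc J ! → fVal s (suc J) 0 ≡ 0
  vanish s<
    rewrite m<n⇒m%n≡m {{suc J !≢0}} s< | m<n⇒m/n≡0 {{J !≢0}} s<J! | m<n⇒m/n≡0 {{suc J !≢0}} s< = refl

digit-vanishes : ∀ n s m J → n ∸ m ≡ suc J → s < J ! → fVal s (n ∸ m) (dSeq n s (suc m)) ≡ 0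
digit-vanishes n s m J n∸m≡ s<
  rewrite dSeq-vanishes n s m (subst (λ t → s < t !) (sym n∸m≡) (<-≤-trans s< (!-mono-≤ (n≤1+n J))))
        | n∸m≡
  = fVal-vanishes s J s<

leading-digits-vanish : ∀ n s k → s < k ! → ∀ m j → m + j + k ≡ n → factoradicFrom n s m j ≡ replicate j 0
leading-digits-vanish n s k s< m zero    _   = refl
leading-digits-vanish n s k s< m (suc j) sum =
  cong₂ _∷_ (digit-vanishes n s m (j + k) n∸m≡ (<-≤-trans s< (!-mono-≤ (m≤n+m k j))))
            (leading-digits-vanish n s k s< (suc m) j (trans (cong (_+ k) (sym (+-suc m j))) sum))
  where
  n∸m≡ : n ∸ m ≡ suc (j + k)
  n∸m≡ = trans (cong (_∸ m) (trans (sym sum) (+-assoc m (suc j) k))) (m+n∸m≡n m (suc (j + k)))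

factoradicFrom-++ : ∀ n s m j k → factoradicFrom n s m (j + k) ≡ factoradicFrom n s m j ++ factoradicFrom n s (m + j) k
factoradicFrom-++ n s m zero    k rewrite +-identityʳ m = refl
factoradicFrom-++ n s m (suc j) k rewrite +-suc m j = cong (_ ∷_) (factoradicFrom-++ n s (suc m) j k)

decode-zeros : ∀ (pre : List ℕ) fs rest → decode (replicate (length pre) 0 ++ fs) (pre ++ rest) ≡ pre ++ decode fs rest
decode-zeros []        fs rest = refl
decode-zeros (x ∷ pre) fs rest = cong (x ∷_) (decode-zeros pre fs rest)

identity : ℕ → List ℕ
identity n = map suc (upTo n)

tailPerm : (n k s : ℕ) → List ℕ
tailPerm n k s = decode (factoradicFrom n s (n ∸ k) k) (drop (n ∸ k) (identity n))

length-identity : ∀ n → length (identity n) ≡ n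
length-identity n = trans (length-map suc (upTo n)) (length-upTo n)

length-suffix : ∀ {n k} → k ≤ n → length (drop (n ∸ k) (identity n)) ≡ k
length-suffix {n} {k} k≤n = trans (length-drop (n ∸ k) (identity n)) (trans (cong (_∸ (n ∸ k)) (length-identity n)) (m∸[m∸n]≡n k≤n))

tailPerm-↭ : ∀ {n k} → k ≤ n → ∀ s → tailPerm n k s ↭ drop (n ∸ k) (identity n)
tailPerm-↭ {n} {k} k≤n s =
  decode-↭ (factoradicFrom-valid n s (n ∸ k) k (m∸n+n≡m k≤n)) _ (length-suffix k≤n)

P-split : ∀ {n k} → k ≤ n → ∀ s → s < k ! → P n s ≡ take (n ∸ k) (identity n) ++ tailPerm n k s
P-split {n} {k} k≤n s s< = begin
  decode (factoradicFrom n s 0 n) ids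
    ≡⟨ cong (λ r → decode (factoradicFrom n s 0 r) ids) (sym (m∸n+n≡m k≤n)) ⟩
  decode (factoradicFrom n s 0 (j + k)) ids
    ≡⟨ cong (λ fs → decode fs ids) (factoradicFrom-++ n s 0 j k) ⟩
  decode (factoradicFrom n s 0 j ++ fs) ids
    ≡⟨ cong (λ zs → decode (zs ++ fs) ids) (leading-digits-vanish n s k s< 0 j (m∸n+n≡m k≤n)) ⟩
  decode (replicate j 0 ++ fs) ids
    ≡⟨ cong₂ (λ l xs → decode (replicate l 0 ++ fs) xs) (sym length-pre) (sym (take++drop≡id j ids)) ⟩
  decode (replicate (length pre) 0 ++ fs) (pre ++ drop j ids)
    ≡⟨ decode-zeros pre fs (drop j ids) ⟩
  pre ++ tailPerm n k s ∎
  where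
  open ≡-Reasoning
  ids = identity n
  j = n ∸ k
  pre = take j ids
  fs = factoradicFrom n s j k
  length-pre : length pre ≡ j
  length-pre = trans (length-take j ids) (m≤n⇒m⊓n≡m (subst (j ≤_) (sym (length-identity n)) (m∸n≤m n k)))

mainTheorem4 : (n : ℕ) → 1 ≤ n → (k : ℕ) → 1 ≤ k → k ≤ n →
    (s : ℕ) → s < k ! → DistLe n s 0 (k ∸ 1)
mainTheorem4 n _ k _ k≤n s s<k!
  with sort-by-transpositions (tailPerm n k 0) (↭-trans (tailPerm-↭ k≤n s) (↭-sym (tailPerm-↭ k≤n 0)))
... | m , m≤ , steps =
  m , subst (λ l → m ≤ l ∸ 1) length-T0 m≤ ,
  subst₂ (Steps m) (sym (P-split k≤n s s<k!)) (sym (P-split k≤n 0 (1≤n! k))) (steps-prefix _ m steps)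
  where
  length-T0 : length (tailPerm n k 0) ≡ k
  length-T0 = trans (↭-length (tailPerm-↭ k≤n 0)) (length-suffix k≤n)
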